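{- Let $G$ and $H$ be finite simple graphs and let $S\subseteq E(G\times H)$. Define a graph $G^*$ whose vertices are the $H$-fibers ${_xH}=\{(x,u):u\in V(H)\}$ for $x\in V(G)$, where ${_xH}$ and ${_yH}$ are adjacent if and only if some edge of $G\times H-S$ has one end in ${_xH}$ and the other in ${_yH}$. If $G^*$ is disconnected, then either (1) $|S|>2\kappa'(G)e(H)$, or (2) $|S|=2\kappa'(G)e(H)$ and $S$ is induced by a minimum edge cut of $G$.
   Context: All graphs are finite, undirected, without loops or multiple edges. $\kappa'(G)$ is the edge connectivity of $G$ and $e(H)$ the number of edges of $H$. The direct product $G\times H$ has vertex set $V(G)\times V(H)$, with $(x,u)$ adjacent to $(y,v)$ if and only if $xy\in E(G)$ and $uv\in E(H)$. A minimum edge cut is an edge set of minimum size whose removal disconnects the graph. For $S_0\subseteq E(G)$, the set induced by $S_0$ is $\{(x,u)(y,v),(x,v)(y,u): xy\in S_0,\ uv\in E(H)\}$. -}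

module Defs where

open import Data.Nat using (ℕ; zero; suc; _+_; _*_; _<ᵇ_; _≤_)
open import Data.Bool using (Bool; true; false; _∧_; not; if_then_else_)
open import Data.Fin using (Fin; toℕ; combine; remQuot)
open import Data.List using (List; map; allFin)
open import Data.Nat.ListAction using (sum)
open import Data.Product using (Σ; _×_; _,_; proj₁; proj₂)
open import Data.Sum using (_⊎_)
open import Relation.Binary.PropositionalEquality using (_≡_; refl; cong₂)
open import Relation.Binary.Construct.Closure.ReflexiveTransitive using (Star)
open import Relation.Nullary using (¬_)

record Graph : Set where
  field
    n     : ℕ
    adj   : Fin n → Fin n → Bool
    adj-sym : ∀ i j → adj i j ≡ adj j i
    adj-irrefl : ∀ i → adj i i ≡ false
open Graph public

-- A set of (unordered) edges of G, represented as a symmetric Bool relation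
-- contained in the adjacency of G.
IsEdgeSubset : (G : Graph) → (Fin (n G) → Fin (n G) → Bool) → Set
IsEdgeSubset G S = (∀ i j → S i j ≡ S j i) × (∀ i j → S i j ≡ true → adj G i j ≡ true)

countPairs : (N : ℕ) → (Fin N → Fin N → Bool) → ℕ
countPairs N f =
  sum (map (λ i → sum (map (λ j → if (toℕ i <ᵇ toℕ j) ∧ f i j then 1 else 0)
                            (allFin N)))
           (allFin N))

card : (G : Graph) → (Fin (n G) → Fin (n G) → Bool) → ℕ
card G S = countPairs (n G) S

e : Graph → ℕ
e G = countPairs (n G) (adj G)

Connected : (N : ℕ) → (Fin N → Fin N → Set) → Set
Connected N R = ∀ i j → Star R i j

Edge : (G : Graph) → Fin (n G) → Fin (n G) → Set
Edge G i j = adj G i j ≡ true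

deleteAdj : (G : Graph) → (Fin (n G) → Fin (n G) → Bool) → Fin (n G) → Fin (n G) → Bool
deleteAdj G S i j = adj G i j ∧ not (S i j)

IsEdgeCut : (G : Graph) → (Fin (n G) → Fin (n G) → Bool) → Set
IsEdgeCut G S = IsEdgeSubset G S × ¬ Connected (n G) (λ i j → deleteAdj G S i j ≡ true)

IsMinEdgeCut : (G : Graph) → (Fin (n G) → Fin (n G) → Bool) → Set
IsMinEdgeCut G S = IsEdgeCut G S × (∀ T → IsEdgeCut G T → card G S ≤ card G T)

IsEdgeConnectivity : Graph → ℕ → Set
IsEdgeConnectivity G k =
  Σ (Fin (n G) → Fin (n G) → Bool) (λ S → IsMinEdgeCut G S × card G S ≡ k)

-- Direct product G × H, vertex (x , u) encoded as combine x u : Fin (n G * n H)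
-- components of a product vertex p = combine x u
fstG : (G H : Graph) → Fin (n G * n H) → Fin (n G)
fstG G H p = proj₁ (remQuot {n G} (n H) p)

sndH : (G H : Graph) → Fin (n G * n H) → Fin (n H)
sndH G H p = proj₂ (remQuot {n G} (n H) p)

prodAdj : (G H : Graph) → Fin (n G * n H) → Fin (n G * n H) → Bool
prodAdj G H p q =
  adj G (fstG G H p) (fstG G H q)
  ∧ adj H (sndH G H p) (sndH G H q)

prodSym : (G H : Graph) → ∀ p q → prodAdj G H p q ≡ prodAdj G H q p
prodSym G H p q =
  cong₂ _∧_ (Graph.adj-sym G (fstG G H p) (fstG G H q))
            (Graph.adj-sym H (sndH G H p) (sndH G H q))

prodIrrefl : (G H : Graph) → ∀ p → prodAdj G H p p ≡ false
prodIrrefl G H p rewrite Graph.adj-irrefl G (fstG G H p) = refl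

_×ᵍ_ : Graph → Graph → Graph
G ×ᵍ H = record { n = n G * n H ; adj = prodAdj G H ; adj-sym = prodSym G H ; adj-irrefl = prodIrrefl G H }

-- The quotient graph G* (on fibers _xH, indexed by x : Fin (n G)):
-- _xH ~ _yH iff some edge of (G × H) - S joins (x,u) and (y,v) for some u, v.
StarAdj : (G H : Graph) → (Fin (n G * n H) → Fin (n G * n H) → Bool) →
          Fin (n G) → Fin (n G) → Set
StarAdj G H S x y =
  Σ (Fin (n H)) λ u → Σ (Fin (n H)) λ v →
    deleteAdj (G ×ᵍ H) S (combine x u) (combine y v) ≡ true

-- The edge set of G × H induced by S₀ ⊆ E(G):
-- {(x,u)(y,v), (x,v)(y,u) : xy ∈ S₀, uv ∈ E(H)}, as a predicate on (unordered) pairs p q.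
Induced : (G H : Graph) → (Fin (n G) → Fin (n G) → Bool) →
          Fin (n G * n H) → Fin (n G * n H) → Set
Induced G H S₀ p q =
  Σ (Fin (n G)) λ x → Σ (Fin (n G)) λ y → Σ (Fin (n H)) λ u → Σ (Fin (n H)) λ v →
    S₀ x y ≡ true × adj H u v ≡ true ×
    (  SameEdge p q (combine x u) (combine y v)
     ⊎ SameEdge p q (combine x v) (combine y u))
  where
    SameEdge : Fin (n G * n H) → Fin (n G * n H) → Fin (n G * n H) → Fin (n G * n H) → Set
    SameEdge p q a b = (p ≡ a × q ≡ b) ⊎ (p ≡ b × q ≡ a)

IsInducedBy : (G H : Graph) → (Fin (n G * n H) → Fin (n G * n H) → Bool) →
              (Fin (n G) → Fin (n G) → Bool) → Set
IsInducedBy G H S S₀ =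
  ∀ p q → (S p q ≡ true → Induced G H S₀ p q) × (Induced G H S₀ p q → S p q ≡ true)

module Submission where

-- Breadth-first search in the finite graph G*, whose adjacency is decidable,
-- yields a colouring A of V(G) using both colours whose true side is closed in
-- G* (Reachability.separation).  The coboundary ∂A is then an edge cut of G, so
-- |∂A| ≥ κ'(G).  Every edge of G × H joining fibres of different colours lies in
-- S, since otherwise those fibres would be adjacent in G*; these crossing edges
-- form the tensor of ∂A with E(H).  Counting ordered pairs of vertices (finite
-- sums, the handshake lemma, and the product formula for tensors) gives
-- 2|S| = 2|∂A| · 2e(H) + r, where r counts the non-crossing edges of S
-- (Fibres.count-S).  If |S| ≤ 2κ'(G)e(H), every inequality is tight (tight):
-- r = 0, so S is exactly the set of crossing edges, and either |∂A| = κ'(G),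
-- making ∂A a minimum edge cut that induces S, or e(H) = 0, in which case S is
-- empty and induced by any minimum edge cut.

open import Defs
open import Data.Nat using (ℕ; zero; suc; _+_; _*_; _<_; _≤_; _<ᵇ_; _<?_; s≤s)
open import Data.Nat.Properties
open import Data.Nat.Tactic.RingSolver using (solve-∀)
import Data.Nat.ListAction as List
open import Algebra.Properties.Semiring.Sum +-*-semiring
  using (sum-syntax; sum-cong-≗; ∑-distrib-+; ∑-comm; *-distribˡ-sum; *-distribʳ-sum)
open import Data.Bool using (Bool; true; false; _∧_; not; _xor_; if_then_else_)
import Data.Bool as Bool
open import Data.Bool.Properties using (∧-zeroʳ; ∧-identityʳ; ∧-assoc; xor-comm)
open import Data.Fin using (Fin; zero; suc; toℕ; combine; remQuot; _↑ˡ_; _↑ʳ_)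
open import Data.Fin.Properties using (toℕ-injective; remQuot-combine; combine-remQuot)
open import Data.List using (map; allFin; tabulate)
open import Data.List.Properties using (map-tabulate)
open import Data.Product using (Σ; Σ-syntax; ∃₂; _×_; _,_; proj₁; proj₂)
open import Data.Sum using (_⊎_; inj₁; inj₂)
open import Data.Empty using (⊥; ⊥-elim)
open import Function using (_∘_; id)
open import Relation.Binary.PropositionalEquality
open import Relation.Nullary using (¬_; yes; no; does)
open import Relation.Nullary.Decidable using (_⊎-dec_; _×-dec_; dec-true; decidable-stable)
import Relation.Unary as U
import Relation.Binary.Definitions as B
open import Relation.Binary.Construct.Closure.ReflexiveTransitive using (Star; ε; _◅_; _◅◅_)
open import Data.Fin.Properties using (any?; all?; ¬∀⟶∃¬)
open import Data.Fin.Subset using (Subset; _∈_; _⊆_; _⊂_; ⁅_⁆; ∣_∣)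
open import Data.Fin.Subset.Properties using (_∈?_; _⊂?_; x∈⁅x⁆; x∈⁅y⁆⇒x≡y; ∣⁅x⁆∣≡1; ∣p∣≤n; p⊂q⇒∣p∣<∣q∣)
open import Data.Vec using (lookup) renaming (tabulate to tabulateᵛ)
open import Data.Vec.Properties using (lookup∘tabulate; lookup⇒[]=; []=⇒lookup)
open import Data.Bool.Properties using (¬-not)

sum-allFin : ∀ N (f : Fin N → ℕ) → List.sum (map f (allFin N)) ≡ ∑[ i < N ] f i
sum-allFin N f = trans (cong List.sum (map-tabulate id f)) (sum-tabulate N f)
  where
  sum-tabulate : ∀ N (f : Fin N → ℕ) → List.sum (tabulate f) ≡ ∑[ i < N ] f i
  sum-tabulate zero    f = refl
  sum-tabulate (suc N) f = cong (f zero +_) (sum-tabulate N (f ∘ suc))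

∑-↑ : ∀ m n (f : Fin (m + n) → ℕ) →
      ∑[ i < m + n ] f i ≡ ∑[ i < m ] f (i ↑ˡ n) + ∑[ j < n ] f (m ↑ʳ j)
∑-↑ zero    n f = refl
∑-↑ (suc m) n f = trans (cong (f zero +_) (∑-↑ m n (f ∘ suc))) (sym (+-assoc (f zero) _ _))

∑-combine : ∀ m n (f : Fin (m * n) → ℕ) →
            ∑[ p < m * n ] f p ≡ ∑[ x < m ] ∑[ u < n ] f (combine x u)
∑-combine zero    n f = refl
∑-combine (suc m) n f =
  trans (∑-↑ n (m * n) f) (cong (∑[ u < n ] f (u ↑ˡ (m * n)) +_) (∑-combine m n (λ p → f (n ↑ʳ p))))

∑≡0⇒≡0 : ∀ n (f : Fin n → ℕ) → ∑[ i < n ] f i ≡ 0 → ∀ i → f i ≡ 0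
∑≡0⇒≡0 (suc n) f ∑≡0 zero    = m+n≡0⇒m≡0 (f zero) ∑≡0
∑≡0⇒≡0 (suc n) f ∑≡0 (suc i) = ∑≡0⇒≡0 n (f ∘ suc) (m+n≡0⇒n≡0 (f zero) ∑≡0) i

ind : Bool → ℕ
ind b = if b then 1 else 0

ind-∧ : ∀ a b → ind (a ∧ b) ≡ ind a * ind b
ind-∧ true  b = sym (+-identityʳ (ind b))
ind-∧ false b = refl

∧≡true⁻ : ∀ {a b} → a ∧ b ≡ true → a ≡ true × b ≡ true
∧≡true⁻ {true} {true} _ = refl , refl

∧≡true⁺ : ∀ {a b} → a ≡ true → b ≡ true → a ∧ b ≡ true
∧≡true⁺ refl refl = refl

xor≡true⇒≢ : ∀ a b → a xor b ≡ true → ¬ a ≡ b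
xor≡true⇒≢ true  true  () _
xor≡true⇒≢ false false () _

ordered : ∀ N → (Fin N → Fin N → Bool) → ℕ
ordered N f = ∑[ i < N ] ∑[ j < N ] ind (f i j)

ordered-split : ∀ N (f g h : Fin N → Fin N → Bool) →
                (∀ i j → ind (f i j) ≡ ind (g i j) + ind (h i j)) →
                ordered N f ≡ ordered N g + ordered N h
ordered-split N f g h split =
  trans (sum-cong-≗ {N} λ i → trans (sum-cong-≗ {N} (split i))
                                     (∑-distrib-+ (λ j → ind (g i j)) (λ j → ind (h i j))))
        (∑-distrib-+ (λ i → ∑[ j < N ] ind (g i j)) (λ i → ∑[ j < N ] ind (h i j)))

ordered≡0 : ∀ N (f : Fin N → Fin N → Bool) → ordered N f ≡ 0 → ∀ i j → f i j ≡ false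
ordered≡0 N f none i j with f i j in fij
... | false = refl
... | true  = ⊥-elim (0≢1+n (sym (trans (cong ind (sym fij))
                 (∑≡0⇒≡0 N _ (∑≡0⇒≡0 N _ none i) j))))

ordered≡2*countPairs : ∀ N (f : Fin N → Fin N → Bool) →
  (∀ i j → f i j ≡ f j i) → (∀ i → f i i ≡ false) → ordered N f ≡ 2 * countPairs N f
ordered≡2*countPairs N f f-sym f-irrefl = begin
  ordered N f
    ≡⟨ ordered-split N f up down one-direction ⟩
  ordered N up + ordered N down
    ≡⟨ cong (ordered N up +_) (∑-comm (λ i j → ind (down i j))) ⟩
  ordered N up + ∑[ j < N ] ∑[ i < N ] ind (down i j)
    ≡⟨ cong (ordered N up +_) (sum-cong-≗ {N} λ j → sum-cong-≗ {N} λ i →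
         cong (λ b → ind ((toℕ j <ᵇ toℕ i) ∧ b)) (f-sym i j)) ⟩
  ordered N up + ordered N up
    ≡⟨ cong (λ c → c + c) (sym (trans (sum-allFin N _) (sum-cong-≗ {N} λ i → sum-allFin N _))) ⟩
  countPairs N f + countPairs N f
    ≡⟨ cong (countPairs N f +_) (sym (+-identityʳ _)) ⟩
  2 * countPairs N f ∎
  where
  open ≡-Reasoning
  up down : Fin N → Fin N → Bool
  up   i j = (toℕ i <ᵇ toℕ j) ∧ f i j
  down i j = (toℕ j <ᵇ toℕ i) ∧ f i j

  trichotomy : ∀ a b → ¬ a ≡ b → ind (a <ᵇ b) + ind (b <ᵇ a) ≡ 1
  trichotomy zero    zero    a≢b = ⊥-elim (a≢b refl)
  trichotomy zero    (suc b) a≢b = refl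
  trichotomy (suc a) zero    a≢b = refl
  trichotomy (suc a) (suc b) a≢b = trichotomy a b (a≢b ∘ cong suc)

  one-direction : ∀ i j → ind (f i j) ≡ ind (up i j) + ind (down i j)
  one-direction i j with f i j in fij
  ... | false rewrite ∧-zeroʳ (toℕ i <ᵇ toℕ j) | ∧-zeroʳ (toℕ j <ᵇ toℕ i) = refl
  ... | true  rewrite ∧-identityʳ (toℕ i <ᵇ toℕ j) | ∧-identityʳ (toℕ j <ᵇ toℕ i) =
    sym (trichotomy (toℕ i) (toℕ j) (i≢j ∘ toℕ-injective))
    where
    i≢j : ¬ i ≡ j
    i≢j refl with trans (sym fij) (f-irrefl i)
    ... | ()

tensor : ∀ {N M} → (Fin N → Fin N → Bool) → (Fin M → Fin M → Bool) →
         Fin (N * M) → Fin (N * M) → Bool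
tensor {N} {M} r s p q =
  r (proj₁ (remQuot {N} M p)) (proj₁ (remQuot {N} M q))
  ∧ s (proj₂ (remQuot {N} M p)) (proj₂ (remQuot {N} M q))

tensor-combine : ∀ {N M} (r : Fin N → Fin N → Bool) (s : Fin M → Fin M → Bool) x u y v →
                 tensor r s (combine x u) (combine y v) ≡ r x y ∧ s u v
tensor-combine {N} {M} r s x u y v =
  cong₂ (λ (a b : Fin N × Fin M) → r (proj₁ a) (proj₁ b) ∧ s (proj₂ a) (proj₂ b))
        (remQuot-combine x u) (remQuot-combine y v)

ordered-tensor : ∀ N M (r : Fin N → Fin N → Bool) (s : Fin M → Fin M → Bool) →
                 ordered (N * M) (tensor r s) ≡ ordered N r * ordered M s
ordered-tensor N M r s = begin
  ordered (N * M) (tensor r s)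
    ≡⟨ ∑-combine N M _ ⟩
  ∑[ x < N ] ∑[ u < M ] ∑[ q < N * M ] ind (tensor r s (combine x u) q)
    ≡⟨ sum-cong-≗ {N} (λ x → sum-cong-≗ {M} λ u → ∑-combine N M _) ⟩
  ∑[ x < N ] ∑[ u < M ] ∑[ y < N ] ∑[ v < M ] ind (tensor r s (combine x u) (combine y v))
    ≡⟨ sum-cong-≗ {N} (λ x → sum-cong-≗ {M} λ u → sum-cong-≗ {N} λ y → sum-cong-≗ {M} λ v →
         trans (cong ind (tensor-combine r s x u y v)) (ind-∧ (r x y) (s u v))) ⟩
  ∑[ x < N ] ∑[ u < M ] ∑[ y < N ] ∑[ v < M ] (ind (r x y) * ind (s u v))
    ≡⟨ sum-cong-≗ {N} (λ x → ∑-comm (λ u y → ∑[ v < M ] (ind (r x y) * ind (s u v)))) ⟩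
  ∑[ x < N ] ∑[ y < N ] ∑[ u < M ] ∑[ v < M ] (ind (r x y) * ind (s u v))
    ≡⟨ sum-cong-≗ {N} (λ x → sum-cong-≗ {N} λ y → sym (factor-left (ind (r x y)))) ⟩
  ∑[ x < N ] ∑[ y < N ] (ind (r x y) * ordered M s)
    ≡⟨ sym (trans (*-distribʳ-sum (ordered M s) (λ x → ∑[ y < N ] ind (r x y)))
                  (sum-cong-≗ {N} λ x → *-distribʳ-sum (ordered M s) (λ y → ind (r x y)))) ⟩
  ordered N r * ordered M s ∎
  where
  open ≡-Reasoning
  factor-left : (c : ℕ) → c * ordered M s ≡ ∑[ u < M ] ∑[ v < M ] (c * ind (s u v))
  factor-left c = trans (*-distribˡ-sum c (λ u → ∑[ v < M ] ind (s u v)))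
                        (sum-cong-≗ {M} λ u → *-distribˡ-sum c (λ v → ind (s u v)))

⟦_⟧ : ∀ {N ℓ} {P : Fin N → Set ℓ} → U.Decidable P → Subset N
⟦ P? ⟧ = tabulateᵛ (does ∘ P?)

∈⟦⟧⁺ : ∀ {N ℓ} {P : Fin N → Set ℓ} (P? : U.Decidable P) {x} → P x → x ∈ ⟦ P? ⟧
∈⟦⟧⁺ P? {x} px = lookup⇒[]= x _ (trans (lookup∘tabulate (does ∘ P?) x) (dec-true (P? x) px))

∈⟦⟧⁻ : ∀ {N ℓ} {P : Fin N → Set ℓ} (P? : U.Decidable P) {x} → x ∈ ⟦ P? ⟧ → P x
∈⟦⟧⁻ P? {x} x∈ with P? x | trans (sym (lookup∘tabulate (does ∘ P?) x)) ([]=⇒lookup x∈)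
... | yes px | _ = px
... | no _   | ()

-- Connectivity of a decidable relation on a finite vertex set, by breadth-first
-- search: the sets stage a m of vertices within m steps of a grow strictly until
-- they are closed under R, so stage a N is closed.
module Reachability {N : ℕ} {R : Fin N → Fin N → Set} (R? : B.Decidable R) where

  Closed : Subset N → Set
  Closed p = ∀ {x y} → x ∈ p → R x y → y ∈ p

  Expand : Subset N → Fin N → Set
  Expand p y = y ∈ p ⊎ Σ[ x ∈ Fin N ] (x ∈ p × R x y)

  Expand? : ∀ p → U.Decidable (Expand p)
  Expand? p y = y ∈? p ⊎-dec any? (λ x → x ∈? p ×-dec R? x y)

  expand : Subset N → Subset N
  expand p = ⟦ Expand? p ⟧

  p⊆expand : ∀ {p} → p ⊆ expand p
  p⊆expand {p} x∈p = ∈⟦⟧⁺ (Expand? p) (inj₁ x∈p)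

  expand⊆ : ∀ {p} → Closed p → expand p ⊆ p
  expand⊆ {p} closed y∈ with ∈⟦⟧⁻ (Expand? p) y∈
  ... | inj₁ y∈p            = y∈p
  ... | inj₂ (x , x∈p , r) = closed x∈p r

  expand-closed : ∀ {p} → Closed p → Closed (expand p)
  expand-closed closed x∈ r = p⊆expand (closed (expand⊆ closed x∈) r)

  closed-or-grows : ∀ p → Closed p ⊎ p ⊂ expand p
  closed-or-grows p with p ⊂? expand p
  ... | yes grows = inj₂ grows
  ... | no stuck  = inj₁ λ {x} {y} x∈p r → decidable-stable (y ∈? p) λ y∉p →
                      stuck (p⊆expand , y , ∈⟦⟧⁺ (Expand? p) (inj₂ (x , x∈p , r)) , y∉p)

  stage : Fin N → ℕ → Subset N
  stage a zero    = ⁅ a ⁆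
  stage a (suc m) = expand (stage a m)

  stage-sound : ∀ a m {y} → y ∈ stage a m → Star R a y
  stage-sound a zero y∈ rewrite x∈⁅y⁆⇒x≡y a y∈ = ε
  stage-sound a (suc m) y∈ with ∈⟦⟧⁻ (Expand? (stage a m)) y∈
  ... | inj₁ y∈stage          = stage-sound a m y∈stage
  ... | inj₂ (x , x∈stage , r) = stage-sound a m x∈stage ◅◅ (r ◅ ε)

  a∈stage : ∀ a m → a ∈ stage a m
  a∈stage a zero    = x∈⁅x⁆ a
  a∈stage a (suc m) = p⊆expand (a∈stage a m)

  stage-grows : ∀ a m → Closed (stage a m) ⊎ m < ∣ stage a m ∣
  stage-grows a zero = inj₂ (≤-reflexive (sym (∣⁅x⁆∣≡1 a)))
  stage-grows a (suc m) with stage-grows a m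
  ... | inj₁ closed = inj₁ (expand-closed closed)
  ... | inj₂ m<∣stage∣ with closed-or-grows (stage a m)
  ...   | inj₁ closed = inj₁ (expand-closed closed)
  ...   | inj₂ grows  = inj₂ (≤-trans (s≤s m<∣stage∣) (p⊂q⇒∣p∣<∣q∣ grows))

  -- the component of a: closed, since it cannot have more than N elements
  component : Fin N → Subset N
  component a = stage a N

  component-closed : ∀ a → Closed (component a)
  component-closed a with stage-grows a N
  ... | inj₁ closed = closed
  ... | inj₂ N<∣c∣  = ⊥-elim (<⇒≱ N<∣c∣ (∣p∣≤n (component a)))

  separation : ¬ Connected N R →
    Σ (Fin N → Bool) λ A → (∀ x y → A x ≡ true → R x y → A y ≡ true) ×
                           ∃₂ λ a b → A a ≡ true × A b ≡ false
  separation disc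
    with ¬∀⟶∃¬ N _ (λ a → all? λ b → b ∈? component a)
                   (λ all-in → disc λ a b → stage-sound a N (all-in a b))
  ... | a , ¬all with ¬∀⟶∃¬ N _ (λ b → b ∈? component a) ¬all
  ... | b , b∉ =
    lookup (component a) ,
    (λ x y Ax r → []=⇒lookup (component-closed a (lookup⇒[]= x _ Ax) r)) ,
    a , b , []=⇒lookup (a∈stage a N) , ¬-not (b∉ ∘ lookup⇒[]= b _)

∂ : (G : Graph) → (Fin (n G) → Bool) → Fin (n G) → Fin (n G) → Bool
∂ G A x y = (A x xor A y) ∧ adj G x y

∂-sym : ∀ G A x y → ∂ G A x y ≡ ∂ G A y x
∂-sym G A x y = cong₂ _∧_ (xor-comm (A x) (A y)) (adj-sym G x y)

∂-irrefl : ∀ G A x → ∂ G A x x ≡ false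
∂-irrefl G A x rewrite adj-irrefl G x = ∧-zeroʳ (A x xor A x)

-- The edges of G - ∂A join vertices of the same colour, so if both colours
-- occur, ∂A is an edge cut.
∂-isEdgeCut : ∀ G A {a b} → A a ≡ true → A b ≡ false → IsEdgeCut G (∂ G A)
∂-isEdgeCut G A {a} {b} Aa Ab =
  (∂-sym G A , λ x y x∂y → proj₂ (∧≡true⁻ {A x xor A y} x∂y)) ,
  λ connected → true≢false (trans (sym Aa) (trans (same-colour (connected a b)) Ab))
  where
  true≢false : ¬ true ≡ false
  true≢false ()

  step : ∀ x y → deleteAdj G (∂ G A) x y ≡ true → A x ≡ A y
  step x y e with A x | A y | adj G x y
  ... | true  | true  | _ = refl
  ... | false | false | _ = refl
  ... | true  | false | true = ⊥-elim (true≢false (sym e))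
  ... | false | true  | true = ⊥-elim (true≢false (sym e))

  same-colour : ∀ {x y} → Star (λ i j → deleteAdj G (∂ G A) i j ≡ true) x y → A x ≡ A y
  same-colour ε       = refl
  same-colour (e ◅ w) = trans (step _ _ e) (same-colour w)

minimum-of-size : ∀ G k T → IsEdgeConnectivity G k → IsEdgeCut G T → card G T ≡ k → IsMinEdgeCut G T
minimum-of-size G k T (T₀ , (_ , T₀-min) , |T₀|≡k) T-cut |T|≡k =
  T-cut , λ U U-cut → subst (_≤ card G U) (trans |T₀|≡k (sym |T|≡k)) (T₀-min U U-cut)

no-edges : ∀ H → e H ≡ 0 → ∀ u v → adj H u v ≡ false
no-edges H e≡0 = ordered≡0 (n H) (adj H)
  (trans (ordered≡2*countPairs (n H) (adj H) (adj-sym H) (adj-irrefl H)) (cong (2 *_) e≡0))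

StarAdj? : ∀ G H S → B.Decidable (StarAdj G H S)
StarAdj? G H S x y = any? λ u → any? λ v → deleteAdj (G ×ᵍ H) S (combine x u) (combine y v) Bool.≟ true

tensor-induced : ∀ G H (S₀ : Fin (n G) → Fin (n G) → Bool) T →
  (∀ x y → S₀ x y ≡ S₀ y x) → (∀ p q → T p q ≡ tensor S₀ (adj H) p q) → IsInducedBy G H T S₀
tensor-induced G H S₀ T S₀-sym T≡ p q = forward , backward
  where
  split : ∀ r → combine (proj₁ (remQuot {n G} (n H) r)) (proj₂ (remQuot {n G} (n H) r)) ≡ r
  split r = combine-remQuot {n G} (n H) r

  forward : T p q ≡ true → Induced G H S₀ p q
  forward Tpq with ∧≡true⁻ {S₀ _ _} (trans (sym (T≡ p q)) Tpq)
  ... | s₀ , h = _ , _ , _ , _ , s₀ , h , inj₁ (inj₁ (sym (split p) , sym (split q)))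

  T-sym : ∀ r t → T r t ≡ T t r
  T-sym r t = trans (T≡ r t) (trans (cong₂ _∧_ (S₀-sym _ _) (adj-sym H _ _)) (sym (T≡ t r)))

  edge : ∀ x y u v → S₀ x y ≡ true → adj H u v ≡ true → T (combine x u) (combine y v) ≡ true
  edge x y u v s₀ h = trans (T≡ _ _) (trans (tensor-combine S₀ (adj H) x u y v) (∧≡true⁺ s₀ h))

  backward : Induced G H S₀ p q → T p q ≡ true
  backward (x , y , u , v , s₀ , h , inj₁ (inj₁ (refl , refl))) = edge x y u v s₀ h
  backward (x , y , u , v , s₀ , h , inj₁ (inj₂ (refl , refl))) = trans (T-sym _ _) (edge x y u v s₀ h)
  backward (x , y , u , v , s₀ , h , inj₂ (inj₁ (refl , refl))) = edge x y v u s₀ (trans (adj-sym H v u) h)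
  backward (x , y , u , v , s₀ , h , inj₂ (inj₂ (refl , refl))) =
    trans (T-sym _ _) (edge x y v u s₀ (trans (adj-sym H v u) h))

-- If H has no edges, neither has G × H; then S ⊆ E(G × H) is empty and is
-- induced by every S₀ (both sides of the definition are vacuous).
edgeless-induced : ∀ G H S → IsEdgeSubset (G ×ᵍ H) S → e H ≡ 0 → ∀ S₀ → IsInducedBy G H S S₀
edgeless-induced G H S (_ , S⊆) e≡0 S₀ p q =
  (λ Spq → ⊥-elim (absurd-edge (proj₂ (∧≡true⁻ {adj G _ _} (S⊆ p q Spq))))) ,
  λ { (_ , _ , u , v , _ , h , _) → ⊥-elim (absurd-edge h) }
  where
  absurd-edge : ∀ {u v} → adj H u v ≡ true → ⊥
  absurd-edge {u} {v} h with trans (sym h) (no-edges H e≡0 u v)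
  ... | ()

tight : ∀ s c h r k → 2 * s ≡ 2 * c * (2 * h) + r → k ≤ c → s ≤ 2 * k * h →
        s ≡ 2 * k * h × r ≡ 0 × (h ≡ 0 ⊎ c ≡ k)
tight s c h r k 2s≡ k≤c s≤ = s≡ , r≡0 , cancel h kh≡ch
  where
  X = 2 * c * (2 * h)

  regroup : ∀ k h → 2 * (2 * k * h) ≡ 2 * k * (2 * h)
  regroup = solve-∀

  four : ∀ k h → 2 * k * (2 * h) ≡ 4 * (k * h)
  four = solve-∀

  4kh≤X : 2 * (2 * k * h) ≤ X
  4kh≤X = ≤-trans (≤-reflexive (regroup k h)) (*-monoˡ-≤ (2 * h) (*-monoʳ-≤ 2 k≤c))

  X+r≤X : X + r ≤ X
  X+r≤X = ≤-trans (≤-reflexive (sym 2s≡)) (≤-trans (*-monoʳ-≤ 2 s≤) 4kh≤X)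

  r≡0 : r ≡ 0
  r≡0 = n≤0⇒n≡0 (+-cancelˡ-≤ X r 0 (subst (X + r ≤_) (sym (+-identityʳ X)) X+r≤X))

  2s≡X : 2 * s ≡ X
  2s≡X = trans 2s≡ (trans (cong (X +_) r≡0) (+-identityʳ X))

  4kh≡X : 2 * (2 * k * h) ≡ X
  4kh≡X = ≤-antisym 4kh≤X (subst (_≤ 2 * (2 * k * h)) 2s≡X (*-monoʳ-≤ 2 s≤))

  s≡ : s ≡ 2 * k * h
  s≡ = *-cancelˡ-≡ s (2 * k * h) 2 (trans 2s≡X (sym 4kh≡X))

  kh≡ch : k * h ≡ c * h
  kh≡ch = *-cancelˡ-≡ (k * h) (c * h) 4
    (trans (sym (four k h)) (trans (sym (regroup k h)) (trans 4kh≡X (four c h))))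

  cancel : ∀ h → k * h ≡ c * h → h ≡ 0 ⊎ c ≡ k
  cancel zero    _  = inj₁ refl
  cancel (suc h) eq = inj₂ (*-cancelʳ-≡ c k (suc h) (sym eq))

Dichotomy : (G H : Graph) → (Fin (n G * n H) → Fin (n G * n H) → Bool) → ℕ → Set
Dichotomy G H S k =
  (2 * k * e H < card (G ×ᵍ H) S)
  ⊎ (card (G ×ᵍ H) S ≡ 2 * k * e H
     × Σ (Fin (n G) → Fin (n G) → Bool) (λ S₀ → IsMinEdgeCut G S₀ × IsInducedBy G H S S₀))

-- The fibre structure of S relative to a colouring A of V(G) whose true side is
-- closed under adjacency in G*: every edge of G × H between fibres of different
-- colours must lie in S, so S contains a copy of ∂A for every edge of H.
module Fibres (G H : Graph) (S : Fin (n G * n H) → Fin (n G * n H) → Bool)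
              (S⊆ : IsEdgeSubset (G ×ᵍ H) S) (A : Fin (n G) → Bool)
              (A-closed : ∀ x y → A x ≡ true → StarAdj G H S x y → A y ≡ true) where

  N M P : ℕ
  N = n G
  M = n H
  P = N * M

  fst : Fin P → Fin N
  fst = fstG G H

  cross : Fin P → Fin P → Bool
  cross = tensor (∂ G A) (adj H)

  fibre-adj : ∀ p q → S p q ≡ false → prodAdj G H p q ≡ true → StarAdj G H S (fst p) (fst q)
  fibre-adj p q Spq≡false pq-edge =
    sndH G H p , sndH G H q ,
    subst₂ (λ p′ q′ → deleteAdj (G ×ᵍ H) S p′ q′ ≡ true)
           (sym (combine-remQuot {N} M p)) (sym (combine-remQuot {N} M q))
           (cong₂ (λ a b → a ∧ not b) pq-edge Spq≡false)

  same-colour : ∀ p q → S p q ≡ false → prodAdj G H p q ≡ true → A (fst p) ≡ A (fst q)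
  same-colour p q Spq≡false pq-edge with A (fst p) in Ap | A (fst q) in Aq
  ... | true  | true  = refl
  ... | false | false = refl
  ... | true  | false = trans (sym (A-closed _ _ Ap (fibre-adj p q Spq≡false pq-edge))) Aq
  ... | false | true  = trans (sym Ap) (A-closed _ _ Aq (fibre-adj q p Sqp≡false qp-edge))
    where
    Sqp≡false = trans (proj₁ S⊆ q p) Spq≡false
    qp-edge   = trans (prodSym G H q p) pq-edge

  cross⊆S : ∀ p q → cross p q ≡ true → S p q ≡ true
  cross⊆S p q pq-cross with S p q in Spq
  ... | true  = refl
  ... | false = ⊥-elim (xor≡true⇒≢ _ _ (proj₁ parts) (same-colour p q Spq (proj₂ parts)))
    where
    x = fst p
    y = fst q
    parts : (A x xor A y) ≡ true × prodAdj G H p q ≡ true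
    parts = ∧≡true⁻ {A x xor A y}
      (trans (sym (∧-assoc (A x xor A y) (adj G x y) (adj H (sndH G H p) (sndH G H q)))) pq-cross)

  rest : Fin P → Fin P → Bool
  rest p q = S p q ∧ not (cross p q)

  S-irrefl : ∀ p → S p p ≡ false
  S-irrefl p with S p p in Spp
  ... | false = refl
  ... | true  = trans (sym (proj₂ S⊆ p p Spp)) (prodIrrefl G H p)

  S-split : ∀ p q → ind (S p q) ≡ ind (cross p q) + ind (rest p q)
  S-split p q with cross p q in pq-cross
  ... | true  rewrite cross⊆S p q pq-cross = refl
  ... | false rewrite ∧-identityʳ (S p q) = refl

  count-S : 2 * card (G ×ᵍ H) S ≡ 2 * card G (∂ G A) * (2 * e H) + ordered P rest
  count-S = begin
    2 * card (G ×ᵍ H) S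
      ≡⟨ sym (ordered≡2*countPairs P S (proj₁ S⊆) S-irrefl) ⟩
    ordered P S
      ≡⟨ ordered-split P S cross rest S-split ⟩
    ordered P cross + ordered P rest
      ≡⟨ cong (_+ ordered P rest) (ordered-tensor N M (∂ G A) (adj H)) ⟩
    ordered N (∂ G A) * ordered M (adj H) + ordered P rest
      ≡⟨ cong (_+ ordered P rest) (cong₂ _*_
           (ordered≡2*countPairs N (∂ G A) (∂-sym G A) (∂-irrefl G A))
           (ordered≡2*countPairs M (adj H) (adj-sym H) (adj-irrefl H))) ⟩
    2 * card G (∂ G A) * (2 * e H) + ordered P rest ∎
    where open ≡-Reasoning

  S≡cross : ordered P rest ≡ 0 → ∀ p q → S p q ≡ cross p q
  S≡cross no-rest p q with cross p q in pq-cross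
  ... | true  = cross⊆S p q pq-cross
  ... | false = trans (sym (∧-identityʳ (S p q)))
                      (subst (λ b → S p q ∧ not b ≡ false) pq-cross (ordered≡0 P rest no-rest p q))

  κ′≤|∂A| : ∀ k → IsEdgeConnectivity G k → ∀ {a b} → A a ≡ true → A b ≡ false → k ≤ card G (∂ G A)
  κ′≤|∂A| k (_ , (_ , S₀-min) , |S₀|≡k) Aa Ab =
    subst (_≤ card G (∂ G A)) |S₀|≡k (S₀-min (∂ G A) (∂-isEdgeCut G A Aa Ab))

  dichotomy : ∀ k → IsEdgeConnectivity G k → ∀ {a b} → A a ≡ true → A b ≡ false → Dichotomy G H S k
  dichotomy k κ′@(S₀ , S₀-min , _) Aa Ab with 2 * k * e H <? card (G ×ᵍ H) S
  ... | yes large = inj₁ large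
  ... | no ¬large with tight _ _ _ _ k count-S (κ′≤|∂A| k κ′ Aa Ab) (≮⇒≥ ¬large)
  ...   | |S|≡ , _ , inj₁ e≡0 =
    inj₂ (|S|≡ , S₀ , S₀-min , edgeless-induced G H S S⊆ e≡0 S₀)
  ...   | |S|≡ , no-rest , inj₂ |∂A|≡k =
    inj₂ (|S|≡ , ∂ G A ,
          minimum-of-size G k (∂ G A) κ′ (∂-isEdgeCut G A Aa Ab) |∂A|≡k ,
          tensor-induced G H (∂ G A) S (∂-sym G A) (S≡cross no-rest))

lemma1 : (G H : Graph) (S : Fin (n G * n H) → Fin (n G * n H) → Bool) →
    IsEdgeSubset (G ×ᵍ H) S →
    (k : ℕ) → IsEdgeConnectivity G k →
    ¬ Connected (n G) (StarAdj G H S) →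
    (2 * k * e H < card (G ×ᵍ H) S)
    ⊎ (card (G ×ᵍ H) S ≡ 2 * k * e H
       × Σ (Fin (n G) → Fin (n G) → Bool) (λ S₀ → IsMinEdgeCut G S₀ × IsInducedBy G H S S₀))
lemma1 G H S S⊆ k κ′ disconnected
  with Reachability.separation (StarAdj? G H S) disconnected
... | A , A-closed , _ , _ , Aa , Ab = Fibres.dichotomy G H S S⊆ A A-closed k κ′ Aa Ab
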